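{- Let $G$ be a local amoeba having a vertex $v$ with $\deg_G(v)=1$. If $H$ is a copy of $G-v$ that is vertex-disjoint from $G$, then $G\cup H$ is both a local amoeba and a global amoeba.
   Context: For a graph $G$ on vertex set $V=\{v_1,\dots,v_n\}$ let $L_G=\{ij: v_iv_j\in E(G)\}$; for $\sigma\in S_n$, $G_\sigma$ is the graph on $V$ with $E(G_\sigma)=\{v_{\sigma^{ -1}(i)}v_{\sigma^{ -1}(j)}: ij\in L_G\}$. An edge-replacement $e\to e'$ ($e\in E(G)$, $e'\in E(\overline G)\cup\{e\}$) is feasible if $G-e+e'\cong G$. Let $R_G$ be the set of feasible replacements $rs\to kl$ (meaning $v_rv_s\to v_kv_l$), $S_G(rs\to kl)=\{\sigma\in S_n: G_\sigma=G-v_rv_s+v_kv_l\}$, and $S_G\le S_n$ the group generated by $\bigcup_{rs\to kl\in R_G}S_G(rs\to kl)$. $G$ is a local amoeba if $S_G=S_n$; $G$ is a global amoeba if there is $T\ge0$ such that $G\cup tK_1$ ($G$ plus $t$ isolated vertices) is a local amoeba for all $t\ge T$. -}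

module Defs where

open import Data.Bool using (Bool; true; false; if_then_else_; _∧_; _∨_)
open import Data.Nat using (ℕ; zero; suc; _+_; _≥_)
open import Data.Fin using (Fin; splitAt; punchIn; _≟_)
open import Data.Fin.Permutation using (Permutation′; _⟨$⟩ʳ_; _⟨$⟩ˡ_; _∘ₚ_; flip; id; _≈_)
open import Data.List using (List; map; allFin)
open import Data.Nat.ListAction using (sum)
open import Data.Product using (Σ; ∃; _×_; _,_)
open import Data.Sum using (_⊎_; inj₁; inj₂)
open import Relation.Binary.PropositionalEquality using (_≡_; _≢_)
open import Relation.Nullary.Decidable using (⌊_⌋)

RawGraph : ℕ → Set
RawGraph n = Fin n → Fin n → Bool

record IsGraph {n : ℕ} (G : RawGraph n) : Set where
  field
    symmetric   : ∀ x y → G x y ≡ G y x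
    irreflexive : ∀ x → G x x ≡ false

_≐_ : ∀ {n} → RawGraph n → RawGraph n → Set
G ≐ H = ∀ x y → G x y ≡ H x y

-- G_σ : E(G_σ) = { v_{σ⁻¹(i)} v_{σ⁻¹(j)} : ij ∈ L_G },
-- i.e. v_a v_b ∈ E(G_σ) iff v_{σ(a)} v_{σ(b)} ∈ E(G).
permute : ∀ {n} → RawGraph n → Permutation′ n → RawGraph n
permute G σ a b = G (σ ⟨$⟩ʳ a) (σ ⟨$⟩ʳ b)

Iso : ∀ {n} → RawGraph n → RawGraph n → Set
Iso G H = ∃ λ (σ : Permutation′ n) → permute G σ ≐ H
  where n = _

samePair : ∀ {n} → Fin n → Fin n → Fin n → Fin n → Bool
samePair x y k l = (⌊ x ≟ k ⌋ ∧ ⌊ y ≟ l ⌋) ∨ (⌊ x ≟ l ⌋ ∧ ⌊ y ≟ k ⌋)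

replace : ∀ {n} → RawGraph n → Fin n → Fin n → Fin n → Fin n → RawGraph n
replace G r s k l x y =
  if samePair x y k l then true else (if samePair x y r s then false else G x y)

-- v_r v_s → v_k v_l is a feasible edge-replacement:
-- e = v_r v_s ∈ E(G), e' = v_k v_l ∈ E(Ḡ) ∪ {e}, and G - e + e' ≅ G.
Feasible : ∀ {n} → RawGraph n → Fin n → Fin n → Fin n → Fin n → Set
Feasible G r s k l =
  G r s ≡ true
  × ((k ≢ l × G k l ≡ false) ⊎ samePair k l r s ≡ true)
  × Iso (replace G r s k l) G

S-rep : ∀ {n} → RawGraph n → Fin n → Fin n → Fin n → Fin n → Permutation′ n → Set
S-rep G r s k l σ = permute G σ ≐ replace G r s k l

Generator : ∀ {n} → RawGraph n → Permutation′ n → Set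
Generator {n} G σ =
  Σ (Fin n) λ r → Σ (Fin n) λ s → Σ (Fin n) λ k → Σ (Fin n) λ l →
    Feasible G r s k l × S-rep G r s k l σ

data Generated {n : ℕ} (P : Permutation′ n → Set) : Permutation′ n → Set where
  gen  : ∀ {σ} → P σ → Generated P σ
  unit : Generated P id
  comp : ∀ {σ τ} → Generated P σ → Generated P τ → Generated P (σ ∘ₚ τ)
  inv  : ∀ {σ} → Generated P σ → Generated P (flip σ)

-- S_G = S_n : every permutation (up to pointwise equality) lies in S_G
LocalAmoeba : ∀ {n} → RawGraph n → Set
LocalAmoeba {n} G =
  ∀ (π : Permutation′ n) → ∃ λ σ → Generated (Generator G) σ × σ ≈ π

union : ∀ {n m} → RawGraph n → RawGraph m → RawGraph (n + m)
union {n} G H x y with splitAt n x | splitAt n y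
... | inj₁ a | inj₁ b = G a b
... | inj₂ a | inj₂ b = H a b
... | _      | _      = false

empty : (t : ℕ) → RawGraph t
empty t _ _ = false

GlobalAmoeba : ∀ {n} → RawGraph n → Set
GlobalAmoeba G = ∃ λ T → ∀ t → t ≥ T → LocalAmoeba (union G (empty t))

deg : ∀ {n} → RawGraph n → Fin n → ℕ
deg {n} G v = sum (map (λ y → if G v y then 1 else 0) (allFin n))

-- G - v (vertex deletion), remaining vertices relabelled in order
deleteVertex : ∀ {m} → RawGraph (suc m) → Fin (suc m) → RawGraph m
deleteVertex G v x y = G (punchIn v x) (punchIn v y)

module Submission where

-- A set P of permutations spans S_n (`Spanned`, the generated subgroup up to
-- pointwise equality) once it spans the "star" transpositions (c x) at one vertex c:
-- every transposition is a conjugate of a star one, and every permutation is a product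
-- of transpositions (Data.Fin.Permutation.Transposition.List).  Generators of S_K come
-- from permutations that move a single edge (`realizes-generator`):
--   * a leaf edge cu swings to any isolated vertex w by the transposition (c w);
--   * in G ∪ H the leaf edge vu moves to vu*, u* the copy of u in H, by the
--     involution τ fixing v and exchanging G − v with H.
-- Generators of a local amoeba A lift to A ∪ B, giving the transpositions inside A.
-- So G ∪ H spans the star at v (conjugating by τ reaches H), and any local amoeba with
-- a leaf c stays local after adding isolated vertices (swinging reaches them); the
-- proposition applies the latter to G ∪ H, where v is still a leaf.

open import Data.Nat using (ℕ; suc; _+_)
open import Data.Fin using (Fin)
open import Data.Product using (_×_)
open import Relation.Binary.PropositionalEquality using (_≡_)

open import Defs
open import Data.Bool using (Bool; true; false; _∧_; _∨_; if_then_else_)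
open import Data.Bool.Properties using (∧-comm; ∨-comm; ∨-identityʳ; ¬-not)
open import Data.Empty using (⊥-elim)
open import Data.Fin using (_≟_; punchIn; punchOut; splitAt; _↑ˡ_; _↑ʳ_)
open import Data.Fin.Properties
  using (+↔⊎; splitAt-↑ˡ; splitAt-↑ʳ; splitAt⁻¹-↑ˡ; splitAt⁻¹-↑ʳ; ↑ˡ-injective; ↑ʳ-injective;
         punchIn-punchOut; punchOut-punchIn; punchOut-cong; punchInᵢ≢i; punchIn-injective)
open import Data.Fin.Permutation
  using (Permutation′; _⟨$⟩ʳ_; _⟨$⟩ˡ_; _∘ₚ_; flip; id; _≈_; transpose; inverseˡ; inverseʳ)
import Data.Fin.Permutation.Components as PC
open import Data.Fin.Permutation.Transposition.List using (TranspositionList; eval; decompose; eval-decompose)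
open import Data.List using ([]; _∷_; map; allFin)
open import Data.List.Membership.Propositional using (_∈_)
open import Data.List.Membership.Propositional.Properties using (∈-allFin)
open import Data.List.Relation.Unary.Any using (here; there)
open import Data.Nat.ListAction using (sum)
open import Data.Nat.Properties using (1+n≢0; suc-injective)
open import Data.Product using (∃; _,_; proj₁; proj₂)
open import Data.Sum using (_⊎_; inj₁; inj₂)
open import Data.Sum.Function.Propositional using (_⊎-↔_)
open import Function using (_∘_; mk↔ₛ′)
open import Function.Properties.Inverse using (↔-trans; ↔-sym; ↔-refl)
open import Relation.Nullary using (¬_; yes; no)
open import Relation.Nullary.Decidable using (⌊_⌋; isYes≗does; dec-true; dec-false)
open import Relation.Binary.PropositionalEquality
  using (_≢_; refl; sym; trans; cong; cong₂; subst; module ≡-Reasoning)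

⌊≟⌋-yes : ∀ {n} {x y : Fin n} → x ≡ y → ⌊ x ≟ y ⌋ ≡ true
⌊≟⌋-yes {x = x} {y} x≡y = trans (isYes≗does (x ≟ y)) (dec-true (x ≟ y) x≡y)

⌊≟⌋-no : ∀ {n} {x y : Fin n} → x ≢ y → ⌊ x ≟ y ⌋ ≡ false
⌊≟⌋-no {x = x} {y} x≢y = trans (isYes≗does (x ≟ y)) (dec-false (x ≟ y) x≢y)

Injective : ∀ {n m} → (Fin n → Fin m) → Set
Injective f = ∀ {a b} → f a ≡ f b → a ≡ b

⌊≟⌋-injective : ∀ {n m} (f : Fin n → Fin m) → Injective f → ∀ a b → ⌊ f a ≟ f b ⌋ ≡ ⌊ a ≟ b ⌋
⌊≟⌋-injective f inj a b with a ≟ b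
... | yes a≡b = ⌊≟⌋-yes (cong f a≡b)
... | no  a≢b = ⌊≟⌋-no (a≢b ∘ inj)

samePair-false : ∀ {n} {x y k l : Fin n} → ¬ (x ≡ k × y ≡ l) → ¬ (x ≡ l × y ≡ k) →
  samePair x y k l ≡ false
samePair-false {x = x} {y} {k} {l} ¬kl ¬lk with x ≟ k | y ≟ l | x ≟ l | y ≟ k
... | yes x≡k | yes y≡l | _      | _      = ⊥-elim (¬kl (x≡k , y≡l))
... | _       | _       | yes x≡l | yes y≡k = ⊥-elim (¬lk (x≡l , y≡k))
... | no _    | _       | no _   | _      = refl
... | no _    | _       | yes _  | no _   = refl
... | yes _   | no _    | no _   | _      = refl
... | yes _   | no _    | yes _  | no _   = refl

samePair-comm : ∀ {n} (x y k l : Fin n) → samePair x y k l ≡ samePair y x k l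
samePair-comm x y k l =
  trans (∨-comm (⌊ x ≟ k ⌋ ∧ ⌊ y ≟ l ⌋) _)
        (cong₂ _∨_ (∧-comm ⌊ x ≟ l ⌋ ⌊ y ≟ k ⌋) (∧-comm ⌊ x ≟ k ⌋ ⌊ y ≟ l ⌋))

samePair-injective : ∀ {n m} (f : Fin n → Fin m) → Injective f → ∀ x y k l →
  samePair (f x) (f y) (f k) (f l) ≡ samePair x y k l
samePair-injective f inj x y k l
  rewrite ⌊≟⌋-injective f inj x k | ⌊≟⌋-injective f inj y l
        | ⌊≟⌋-injective f inj x l | ⌊≟⌋-injective f inj y k = refl

samePair-pivot : ∀ {n} {p l : Fin n} (y : Fin n) → p ≢ l → samePair p y p l ≡ ⌊ y ≟ l ⌋
samePair-pivot {p = p} {l} y p≢l rewrite ⌊≟⌋-yes {x = p} refl | ⌊≟⌋-no p≢l = ∨-identityʳ _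

replace-unchanged : ∀ {n} (K : RawGraph n) {r s k l x y : Fin n} →
  samePair x y k l ≡ false → samePair x y r s ≡ false → replace K r s k l x y ≡ K x y
replace-unchanged K new old rewrite new | old = refl

replace-pivot-row : ∀ {n} (K : RawGraph n) {p s l : Fin n} → p ≢ s → p ≢ l → ∀ y →
  replace K p s p l p y ≡ (if ⌊ y ≟ l ⌋ then true else (if ⌊ y ≟ s ⌋ then false else K p y))
replace-pivot-row K p≢s p≢l y rewrite samePair-pivot y p≢l | samePair-pivot y p≢s = refl

replace-pivot-away : ∀ {n} (K : RawGraph n) {p s l x y : Fin n} → x ≢ p → y ≢ p →
  replace K p s p l x y ≡ K x y
replace-pivot-away K x≢p y≢p =
  replace-unchanged K (samePair-false (x≢p ∘ proj₁) (y≢p ∘ proj₂))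
                      (samePair-false (x≢p ∘ proj₁) (y≢p ∘ proj₂))

Undirected : ∀ {n} → RawGraph n → Set
Undirected K = ∀ x y → K x y ≡ K y x

permute-undirected : ∀ {n} {K : RawGraph n} → Undirected K → ∀ σ → Undirected (permute K σ)
permute-undirected sym-K σ x y = sym-K (σ ⟨$⟩ʳ x) (σ ⟨$⟩ʳ y)

replace-undirected : ∀ {n} {K : RawGraph n} → Undirected K → ∀ r s k l → Undirected (replace K r s k l)
replace-undirected sym-K r s k l x y
  rewrite samePair-comm x y k l | samePair-comm x y r s | sym-K x y = refl

≐-pivot : ∀ {n} {X Y : RawGraph n} → Undirected X → Undirected Y → (p : Fin n) →
  (∀ y → X p y ≡ Y p y) → (∀ x y → x ≢ p → y ≢ p → X x y ≡ Y x y) → X ≐ Y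
≐-pivot {X = X} {Y} sym-X sym-Y p row away x y with x ≟ p | y ≟ p
... | yes refl | _        = row y
... | no _     | yes refl = trans (sym-X x p) (trans (row x) (sym-Y p x))
... | no x≢p   | no y≢p   = away x y x≢p y≢p

permute-inverse : ∀ {n} {K R : RawGraph n} (σ : Permutation′ n) → permute K σ ≐ R →
  permute R (flip σ) ≐ K
permute-inverse {K = K} σ K≐R x y =
  trans (sym (K≐R (σ ⟨$⟩ˡ x) (σ ⟨$⟩ˡ y))) (cong₂ K (inverseʳ σ) (inverseʳ σ))

module _ {n : ℕ} where

  transpose-cases : ∀ (Q : Fin n → Fin n → Set) i j k →
    (k ≡ i → Q k j) → (k ≡ j → k ≢ i → Q k i) → (k ≢ i → k ≢ j → Q k k) →
    Q k (PC.transpose i j k)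
  transpose-cases Q i j k at-i at-j elsewhere with k ≟ i
  ... | yes k≡i = at-i k≡i
  ... | no k≢i with k ≟ j
  ...   | yes k≡j = at-j k≡j k≢i
  ...   | no k≢j  = elsewhere k≢i k≢j

  transpose-first : ∀ (i j : Fin n) → PC.transpose i j i ≡ j
  transpose-first i j = transpose-cases (λ k t → t ≡ j) i j i (λ _ → refl) (λ i≡j _ → i≡j) (λ i≢i _ → ⊥-elim (i≢i refl))

  transpose-second : ∀ (i j : Fin n) → PC.transpose i j j ≡ i
  transpose-second i j = transpose-cases (λ k t → t ≡ i) i j j (λ j≡i → j≡i) (λ _ _ → refl) (λ _ j≢j → ⊥-elim (j≢j refl))

  transpose-elsewhere : ∀ {i j k : Fin n} → k ≢ i → k ≢ j → PC.transpose i j k ≡ k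
  transpose-elsewhere {i} {j} {k} k≢i k≢j =
    transpose-cases (λ k t → t ≡ k) i j k (⊥-elim ∘ k≢i) (λ k≡j _ → ⊥-elim (k≢j k≡j)) (λ _ _ → refl)

  transpose-involutive : ∀ (i j k : Fin n) → PC.transpose i j (PC.transpose i j k) ≡ k
  transpose-involutive i j k = transpose-cases (λ k t → PC.transpose i j t ≡ k) i j k
    (λ k≡i → trans (transpose-second i j) (sym k≡i))
    (λ k≡j _ → trans (transpose-first i j) (sym k≡j))
    transpose-elsewhere

transpose-natural : ∀ {n m} (f : Fin n → Fin m) → Injective f → ∀ i j k →
  PC.transpose (f i) (f j) (f k) ≡ f (PC.transpose i j k)
transpose-natural f inj i j k = transpose-cases (λ k t → PC.transpose (f i) (f j) (f k) ≡ f t) i j k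
  (λ k≡i → trans (cong (PC.transpose (f i) (f j) ∘ f) k≡i) (transpose-first (f i) (f j)))
  (λ k≡j _ → trans (cong (PC.transpose (f i) (f j) ∘ f) k≡j) (transpose-second (f i) (f j)))
  (λ k≢i k≢j → transpose-elsewhere (k≢i ∘ inj) (k≢j ∘ inj))

permutation-injective : ∀ {n} (ρ : Permutation′ n) → Injective (ρ ⟨$⟩ʳ_)
permutation-injective ρ {a} {b} ρa≡ρb =
  trans (sym (inverseˡ ρ)) (trans (cong (ρ ⟨$⟩ˡ_) ρa≡ρb) (inverseˡ ρ))

-- Conjugating (a b) by ρ gives (ρa ρb); composition `_∘ₚ_` is diagrammatic.
transpose-conjugate : ∀ {n} (ρ : Permutation′ n) a b →
  (flip ρ ∘ₚ transpose a b ∘ₚ ρ) ≈ transpose (ρ ⟨$⟩ʳ a) (ρ ⟨$⟩ʳ b)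
transpose-conjugate ρ a b x = begin
  ρ ⟨$⟩ʳ PC.transpose a b (ρ ⟨$⟩ˡ x)                        ≡⟨ transpose-natural (ρ ⟨$⟩ʳ_) (permutation-injective ρ) a b _ ⟨
  PC.transpose (ρ ⟨$⟩ʳ a) (ρ ⟨$⟩ʳ b) (ρ ⟨$⟩ʳ (ρ ⟨$⟩ˡ x))    ≡⟨ cong (PC.transpose (ρ ⟨$⟩ʳ a) (ρ ⟨$⟩ʳ b)) (inverseʳ ρ) ⟩
  PC.transpose (ρ ⟨$⟩ʳ a) (ρ ⟨$⟩ʳ b) x                      ∎
  where open ≡-Reasoning

record Spanned {n : ℕ} (P : Permutation′ n → Set) (π : Permutation′ n) : Set where
  constructor spanned
  field
    {word}    : Permutation′ n
    generated : Generated P word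
    agrees    : word ≈ π

module _ {n : ℕ} {P : Permutation′ n → Set} where

  spanned-≈ : ∀ {π ρ} → Spanned P π → π ≈ ρ → Spanned P ρ
  spanned-≈ (spanned g σ≈π) π≈ρ = spanned g (λ i → trans (σ≈π i) (π≈ρ i))

  spanned-id : Spanned P id
  spanned-id = spanned unit (λ _ → refl)

  spanned-gen : ∀ {σ} → P σ → Spanned P σ
  spanned-gen p = spanned (gen p) (λ _ → refl)

  spanned-∘ : ∀ {π ρ} → Spanned P π → Spanned P ρ → Spanned P (π ∘ₚ ρ)
  spanned-∘ {π} {ρ} (spanned {σ} g σ≈π) (spanned {τ} h τ≈ρ) =
    spanned (comp g h) (λ i → trans (cong (τ ⟨$⟩ʳ_) (σ≈π i)) (τ≈ρ (π ⟨$⟩ʳ i)))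

  spanned-flip : ∀ {π} → Spanned P π → Spanned P (flip π)
  spanned-flip {π} (spanned {σ} g σ≈π) = spanned (inv g) λ i → begin
    σ ⟨$⟩ˡ i                          ≡⟨ inverseˡ π ⟨
    π ⟨$⟩ˡ (π ⟨$⟩ʳ (σ ⟨$⟩ˡ i))        ≡⟨ cong (π ⟨$⟩ˡ_) (σ≈π (σ ⟨$⟩ˡ i)) ⟨
    π ⟨$⟩ˡ (σ ⟨$⟩ʳ (σ ⟨$⟩ˡ i))        ≡⟨ cong (π ⟨$⟩ˡ_) (inverseʳ σ) ⟩
    π ⟨$⟩ˡ i                          ∎
    where open ≡-Reasoning

  spanned-transpose-conjugate : ∀ {ρ a b} → Spanned P ρ → Spanned P (transpose a b) →
    Spanned P (transpose (ρ ⟨$⟩ʳ a) (ρ ⟨$⟩ʳ b))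
  spanned-transpose-conjugate {ρ} {a} {b} sρ sab =
    spanned-≈ (spanned-∘ (spanned-flip sρ) (spanned-∘ sab sρ)) (transpose-conjugate ρ a b)

  -- The transpositions through one vertex c span every transposition:
  -- (i j) is the conjugate of (c (ρ j)) by ρ = (c i).
  star-transpositions : (c : Fin n) → (∀ x → Spanned P (transpose c x)) →
    ∀ i j → Spanned P (transpose i j)
  star-transpositions c star i j =
    spanned-≈ (spanned-transpose-conjugate (star i) (star (ρ ⟨$⟩ʳ j)))
              (λ x → cong₂ (λ a b → PC.transpose a b x) (transpose-first c i) (transpose-involutive c i j))
    where ρ = transpose c i

  transpositions-span : (∀ i j → Spanned P (transpose i j)) → ∀ π → Spanned P π
  transpositions-span all π = spanned-≈ (product (decompose π)) (eval-decompose π)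
    where
      product : (xs : TranspositionList n) → Spanned P (eval xs)
      product []             = spanned-id
      product ((i , j) ∷ xs) = spanned-∘ (all i j) (product xs)

  star-spans : (c : Fin n) → (∀ x → Spanned P (transpose c x)) → ∀ π → Spanned P π
  star-spans c star = transpositions-span (star-transpositions c star)

local-amoeba : ∀ {n} {K : RawGraph n} → (∀ π → Spanned (Generator K) π) → LocalAmoeba K
local-amoeba span π with span π
... | spanned g σ≈π = _ , g , σ≈π

amoeba-spans : ∀ {n} {K : RawGraph n} → LocalAmoeba K → ∀ π → Spanned (Generator K) π
amoeba-spans amoeba π with amoeba π
... | _ , g , σ≈π = spanned g σ≈π

realizes-generator : ∀ {n} {K : RawGraph n} {r s k l : Fin n} (σ : Permutation′ n) →
  K r s ≡ true → k ≢ l → K k l ≡ false → permute K σ ≐ replace K r s k l → Generator K σ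
realizes-generator {r = r} {s} {k} {l} σ edge k≢l non-edge moves =
  r , s , k , l , (edge , inj₁ (k≢l , non-edge) , (flip σ , permute-inverse σ moves)) , moves

record Pendant {n : ℕ} (K : RawGraph n) (c u : Fin n) : Set where
  constructor pendant
  field
    adjacent : K c u ≡ true
    only     : ∀ y → K c y ≡ true → y ≡ u

Isolated : ∀ {n} → RawGraph n → Fin n → Set
Isolated K w = ∀ y → K w y ≡ false

module _ {n : ℕ} {K : RawGraph n} {c u : Fin n} (leaf : Pendant K c u) where

  pendant-non-neighbour : ∀ {y} → y ≢ u → K c y ≡ false
  pendant-non-neighbour {y} y≢u = ¬-not (y≢u ∘ Pendant.only leaf y)

  pendant-row : ∀ y → K c y ≡ ⌊ y ≟ u ⌋
  pendant-row y with y ≟ u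
  ... | yes refl = Pendant.adjacent leaf
  ... | no y≢u   = pendant-non-neighbour y≢u

  pendant-distinct : IsGraph K → c ≢ u
  pendant-distinct graph refl with trans (sym (Pendant.adjacent leaf)) (IsGraph.irreflexive graph c)
  ... | ()

  pendant-move-row : c ≢ u → ∀ {l} → c ≢ l → ∀ y → replace K c u c l c y ≡ ⌊ y ≟ l ⌋
  pendant-move-row c≢u {l} c≢l y = trans (replace-pivot-row K c≢u c≢l y) (indicator y)
    where
      indicator : ∀ y → (if ⌊ y ≟ l ⌋ then true else (if ⌊ y ≟ u ⌋ then false else K c y)) ≡ ⌊ y ≟ l ⌋
      indicator y with y ≟ l | y ≟ u
      ... | yes _ | _        = refl
      ... | no _  | yes _    = refl
      ... | no _  | no y≢u   = pendant-non-neighbour y≢u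

indicator : ∀ {A : Set} → (A → Bool) → A → ℕ
indicator f y = if f y then 1 else 0

indicator-sum-zero : ∀ {A : Set} (f : A → Bool) xs → sum (map (indicator f) xs) ≡ 0 →
  ∀ z → z ∈ xs → f z ≡ false
indicator-sum-zero f (x ∷ xs) sum≡0 z z∈ with f x in fx
... | true = ⊥-elim (1+n≢0 sum≡0)
indicator-sum-zero f (x ∷ xs) sum≡0 z (here refl) | false = fx
indicator-sum-zero f (x ∷ xs) sum≡0 z (there z∈)  | false = indicator-sum-zero f xs sum≡0 z z∈

indicator-sum-one : ∀ {A : Set} (f : A → Bool) xs → sum (map (indicator f) xs) ≡ 1 →
  ∃ λ u → f u ≡ true × (∀ z → z ∈ xs → f z ≡ true → z ≡ u)
indicator-sum-one f (x ∷ xs) sum≡1 with f x in fx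
... | true = x , fx , only-x
  where
    only-x : ∀ z → z ∈ x ∷ xs → f z ≡ true → z ≡ x
    only-x z (here z≡x) _     = z≡x
    only-x z (there z∈) fz≡true with trans (sym fz≡true) (indicator-sum-zero f xs (suc-injective sum≡1) z z∈)
    ... | ()
... | false with indicator-sum-one f xs sum≡1
...   | u , fu , only-u = u , fu , only-u′
  where
    only-u′ : ∀ z → z ∈ x ∷ xs → f z ≡ true → z ≡ u
    only-u′ z (here refl) fz≡true with trans (sym fz≡true) fx
    ... | ()
    only-u′ z (there z∈) fz≡true = only-u z z∈ fz≡true

degree-one-pendant : ∀ {n} (K : RawGraph n) v → deg K v ≡ 1 → ∃ λ u → Pendant K v u
degree-one-pendant {n} K v deg≡1 with indicator-sum-one (K v) (allFin n) deg≡1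
... | u , Kvu , only = u , pendant Kvu (λ z → only z (∈-allFin z))

module Swing {n : ℕ} {K : RawGraph n} {c u w : Fin n} (graph : IsGraph K)
  (leaf : Pendant K c u) (isolated : Isolated K w) (c≢w : c ≢ w) where

  open IsGraph graph renaming (symmetric to sym-K)

  private
    tf : Fin n → Fin n
    tf = PC.transpose c w

  Kuc : K u c ≡ true
  Kuc = trans (sym-K u c) (Pendant.adjacent leaf)

  Kuw : K u w ≡ false
  Kuw = trans (sym-K u w) (isolated u)

  u≢c : u ≢ c
  u≢c = pendant-distinct leaf graph ∘ sym

  u≢w : u ≢ w
  u≢w u≡w with trans (sym Kuc) (trans (cong (λ z → K z c) u≡w) (isolated c))
  ... | ()

  quiet : ∀ {z y} → z ≡ c ⊎ z ≡ w → y ≢ u → K z y ≡ false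
  quiet (inj₁ refl) y≢u = pendant-non-neighbour leaf y≢u
  quiet (inj₂ refl) _   = isolated _

  moved-away : ∀ {y} → y ≢ u → tf y ≢ u
  moved-away {y} y≢u ty≡u =
    y≢u (trans (sym (transpose-involutive c w y)) (trans (cong tf ty≡u) (transpose-elsewhere u≢c u≢w)))

  -- Row u of K − uc + uw (see replace-pivot-row).
  new-row : Fin n → Bool
  new-row y = if ⌊ y ≟ w ⌋ then true else (if ⌊ y ≟ c ⌋ then false else K u y)

  swing-row : ∀ y → K u (tf y) ≡ new-row y
  swing-row y = transpose-cases (λ y ty → K u ty ≡ new-row y) c w y at-c at-w elsewhere
    where
      at-c : y ≡ c → K u w ≡ new-row y
      at-c y≡c rewrite ⌊≟⌋-no (c≢w ∘ trans (sym y≡c)) | ⌊≟⌋-yes y≡c = Kuw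
      at-w : y ≡ w → y ≢ c → K u c ≡ new-row y
      at-w y≡w _ rewrite ⌊≟⌋-yes y≡w = Kuc
      elsewhere : y ≢ c → y ≢ w → K u y ≡ new-row y
      elsewhere y≢c y≢w rewrite ⌊≟⌋-no y≢w | ⌊≟⌋-no y≢c = refl

  -- Away from u, both K and its swap have no edges at c or w.
  swing-away : ∀ x y → x ≢ u → y ≢ u → K (tf x) (tf y) ≡ K x y
  swing-away x y x≢u y≢u = transpose-cases (λ x tx → K tx (tf y) ≡ K x y) c w x
    (λ x≡c → trans (quiet (inj₂ refl) (moved-away y≢u)) (sym (quiet (inj₁ x≡c) y≢u)))
    (λ x≡w _ → trans (quiet (inj₁ refl) (moved-away y≢u)) (sym (quiet (inj₂ x≡w) y≢u)))
    (λ _ _ → transpose-cases (λ y ty → K x ty ≡ K x y) c w y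
      (λ y≡c → trans (sym-K x w) (trans (quiet (inj₂ refl) x≢u) (sym (trans (sym-K x y) (quiet (inj₁ y≡c) x≢u)))))
      (λ y≡w _ → trans (sym-K x c) (trans (quiet (inj₁ refl) x≢u) (sym (trans (sym-K x y) (quiet (inj₂ y≡w) x≢u)))))
      (λ _ _ → refl))

  swing : permute K (transpose c w) ≐ replace K u c u w
  swing = ≐-pivot (permute-undirected sym-K (transpose c w)) (replace-undirected sym-K u c u w) u
    (λ y → trans (cong (λ z → K z (tf y)) (transpose-elsewhere u≢c u≢w))
                 (trans (swing-row y) (sym (replace-pivot-row K u≢c u≢w y))))
    (λ x y x≢u y≢u → trans (swing-away x y x≢u y≢u) (sym (replace-pivot-away K x≢u y≢u)))

  pendant-swap-generator : Generator K (transpose c w)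
  pendant-swap-generator = realizes-generator (transpose c w) Kuc u≢w Kuw swing

module DisjointUnion {n m : ℕ} where

  L : Fin n → Fin (n + m)
  L a = a ↑ˡ m

  R : Fin m → Fin (n + m)
  R b = n ↑ʳ b

  data Side : Fin (n + m) → Set where
    left  : (a : Fin n) → Side (L a)
    right : (b : Fin m) → Side (R b)

  side : ∀ x → Side x
  side x with splitAt n x in split
  ... | inj₁ a = subst Side (splitAt⁻¹-↑ˡ split) (left a)
  ... | inj₂ b = subst Side (splitAt⁻¹-↑ʳ split) (right b)

  L-injective : Injective L
  L-injective {a} {b} = ↑ˡ-injective m a b

  R-injective : Injective R
  R-injective {a} {b} = ↑ʳ-injective n a b

  L≢R : ∀ {a b} → L a ≢ R b
  L≢R {a} {b} La≡Rb with trans (sym (splitAt-↑ˡ n a m)) (trans (cong (splitAt n) La≡Rb) (splitAt-↑ʳ n m b))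
  ... | ()

  module _ (A : RawGraph n) (B : RawGraph m) where

    union-LL : ∀ a b → union A B (L a) (L b) ≡ A a b
    union-LL a b rewrite splitAt-↑ˡ n a m | splitAt-↑ˡ n b m = refl

    union-LR : ∀ a b → union A B (L a) (R b) ≡ false
    union-LR a b rewrite splitAt-↑ˡ n a m | splitAt-↑ʳ n m b = refl

    union-RL : ∀ a b → union A B (R a) (L b) ≡ false
    union-RL a b rewrite splitAt-↑ʳ n m a | splitAt-↑ˡ n b m = refl

    union-RR : ∀ a b → union A B (R a) (R b) ≡ B a b
    union-RR a b rewrite splitAt-↑ʳ n m a | splitAt-↑ʳ n m b = refl

  union-isGraph : ∀ {A : RawGraph n} {B : RawGraph m} → IsGraph A → IsGraph B → IsGraph (union A B)
  union-isGraph {A} {B} graph-A graph-B = record { symmetric = symmetric′ ; irreflexive = irreflexive′ }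
    where
      symmetric′ : ∀ x y → union A B x y ≡ union A B y x
      symmetric′ x y with side x | side y
      ... | left a  | left b  = trans (union-LL A B a b) (trans (IsGraph.symmetric graph-A a b) (sym (union-LL A B b a)))
      ... | left a  | right b = trans (union-LR A B a b) (sym (union-RL A B b a))
      ... | right a | left b  = trans (union-RL A B a b) (sym (union-LR A B b a))
      ... | right a | right b = trans (union-RR A B a b) (trans (IsGraph.symmetric graph-B a b) (sym (union-RR A B b a)))
      irreflexive′ : ∀ x → union A B x x ≡ false
      irreflexive′ x with side x
      ... | left a  = trans (union-LL A B a a) (IsGraph.irreflexive graph-A a)
      ... | right b = trans (union-RR A B b b) (IsGraph.irreflexive graph-B b)

  union-cong : ∀ {A A′ : RawGraph n} (B : RawGraph m) → A ≐ A′ → union A B ≐ union A′ B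
  union-cong {A} {A′} B A≐A′ x y with side x | side y
  ... | left a  | left b  = trans (union-LL A B a b) (trans (A≐A′ a b) (sym (union-LL A′ B a b)))
  ... | left a  | right b = trans (union-LR A B a b) (sym (union-LR A′ B a b))
  ... | right a | left b  = trans (union-RL A B a b) (sym (union-RL A′ B a b))
  ... | right a | right b = trans (union-RR A B a b) (sym (union-RR A′ B a b))

  pendant-union : ∀ {A : RawGraph n} {c u} (B : RawGraph m) → Pendant A c u → Pendant (union A B) (L c) (L u)
  pendant-union {A} {c} {u} B leaf = pendant (trans (union-LL A B c u) (Pendant.adjacent leaf)) only
    where
      only : ∀ y → union A B (L c) y ≡ true → y ≡ L u
      only y Ucy with side y
      ... | left a  = cong L (Pendant.only leaf a (trans (sym (union-LL A B c a)) Ucy))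
      ... | right b with trans (sym Ucy) (union-LR A B c b)
      ...   | ()

  isolated-union : ∀ (A : RawGraph n) {B : RawGraph m} {b} → Isolated B b → Isolated (union A B) (R b)
  isolated-union A {B} {b} isolated y with side y
  ... | left a   = union-RL A B b a
  ... | right b′ = trans (union-RR A B b b′) (isolated b′)

  liftˡ : Permutation′ n → Permutation′ (n + m)
  liftˡ σ = ↔-trans +↔⊎ (↔-trans (σ ⊎-↔ ↔-refl) (↔-sym +↔⊎))

  liftˡ-L : ∀ σ a → liftˡ σ ⟨$⟩ʳ L a ≡ L (σ ⟨$⟩ʳ a)
  liftˡ-L σ a rewrite splitAt-↑ˡ n a m = refl

  liftˡ-R : ∀ σ b → liftˡ σ ⟨$⟩ʳ R b ≡ R b
  liftˡ-R σ b rewrite splitAt-↑ʳ n m b = refl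

  liftˡ-id : liftˡ id ≈ id
  liftˡ-id x with side x
  ... | left a  = liftˡ-L id a
  ... | right b = liftˡ-R id b

  liftˡ-∘ : ∀ σ τ → (liftˡ σ ∘ₚ liftˡ τ) ≈ liftˡ (σ ∘ₚ τ)
  liftˡ-∘ σ τ x with side x
  ... | left a  rewrite liftˡ-L σ a | liftˡ-L τ (σ ⟨$⟩ʳ a) | liftˡ-L (σ ∘ₚ τ) a = refl
  ... | right b rewrite liftˡ-R σ b | liftˡ-R τ b | liftˡ-R (σ ∘ₚ τ) b = refl

  liftˡ-flip : ∀ σ → flip (liftˡ σ) ≈ liftˡ (flip σ)
  liftˡ-flip σ x with side x
  ... | left a  rewrite splitAt-↑ˡ n a m = refl
  ... | right b rewrite splitAt-↑ʳ n m b = refl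

  liftˡ-cong : ∀ {σ π} → σ ≈ π → liftˡ σ ≈ liftˡ π
  liftˡ-cong {σ} {π} σ≈π x with side x
  ... | left a  = trans (liftˡ-L σ a) (trans (cong L (σ≈π a)) (sym (liftˡ-L π a)))
  ... | right b = trans (liftˡ-R σ b) (sym (liftˡ-R π b))

  liftˡ-transpose : ∀ a b → liftˡ (transpose a b) ≈ transpose (L a) (L b)
  liftˡ-transpose a b x with side x
  ... | left c  = trans (liftˡ-L (transpose a b) c) (sym (transpose-natural L L-injective a b c))
  ... | right c = trans (liftˡ-R (transpose a b) c) (sym (transpose-elsewhere (L≢R ∘ sym) (L≢R ∘ sym)))

  permute-union : ∀ (A : RawGraph n) (B : RawGraph m) ρ → permute (union A B) (liftˡ ρ) ≐ union (permute A ρ) B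
  permute-union A B ρ x y with side x | side y
  ... | left a  | left b  = trans (cong₂ (union A B) (liftˡ-L ρ a) (liftˡ-L ρ b))
                                  (trans (union-LL A B _ _) (sym (union-LL (permute A ρ) B a b)))
  ... | left a  | right b = trans (cong₂ (union A B) (liftˡ-L ρ a) (liftˡ-R ρ b))
                                  (trans (union-LR A B _ _) (sym (union-LR (permute A ρ) B a b)))
  ... | right a | left b  = trans (cong₂ (union A B) (liftˡ-R ρ a) (liftˡ-L ρ b))
                                  (trans (union-RL A B _ _) (sym (union-RL (permute A ρ) B a b)))
  ... | right a | right b = trans (cong₂ (union A B) (liftˡ-R ρ a) (liftˡ-R ρ b))
                                  (trans (union-RR A B _ _) (sym (union-RR (permute A ρ) B a b)))

  replace-union : ∀ (A : RawGraph n) (B : RawGraph m) r s k l →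
    replace (union A B) (L r) (L s) (L k) (L l) ≐ union (replace A r s k l) B
  replace-union A B r s k l x y with side x | side y
  ... | left a  | left b
    rewrite samePair-injective L L-injective a b k l | samePair-injective L L-injective a b r s
          | union-LL A B a b | union-LL (replace A r s k l) B a b = refl
  ... | left a  | right b =
    trans (replace-unchanged (union A B) {L r} {L s} {L k} {L l} (right-apart k l) (right-apart r s))
          (trans (union-LR A B a b) (sym (union-LR (replace A r s k l) B a b)))
    where right-apart : ∀ i j → samePair (L a) (R b) (L i) (L j) ≡ false
          right-apart i j = samePair-false {x = L a} {R b} {L i} {L j} (L≢R ∘ sym ∘ proj₂) (L≢R ∘ sym ∘ proj₂)
  ... | right a | left b  =
    trans (replace-unchanged (union A B) {L r} {L s} {L k} {L l} (right-apart k l) (right-apart r s))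
          (trans (union-RL A B a b) (sym (union-RL (replace A r s k l) B a b)))
    where right-apart : ∀ i j → samePair (R a) (L b) (L i) (L j) ≡ false
          right-apart i j = samePair-false {x = R a} {L b} {L i} {L j} (L≢R ∘ sym ∘ proj₁) (L≢R ∘ sym ∘ proj₁)
  ... | right a | right b =
    trans (replace-unchanged (union A B) {L r} {L s} {L k} {L l} (right-apart k l) (right-apart r s))
          (trans (union-RR A B a b) (sym (union-RR (replace A r s k l) B a b)))
    where right-apart : ∀ i j → samePair (R a) (R b) (L i) (L j) ≡ false
          right-apart i j = samePair-false {x = R a} {R b} {L i} {L j} (L≢R ∘ sym ∘ proj₁) (L≢R ∘ sym ∘ proj₁)

  permute-union-≐ : ∀ {X Y : RawGraph n} (B : RawGraph m) ρ → permute X ρ ≐ Y →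
    permute (union X B) (liftˡ ρ) ≐ union Y B
  permute-union-≐ {X} B ρ X≐Y x y = trans (permute-union X B ρ x y) (union-cong B X≐Y x y)

  lift-generator : ∀ {A : RawGraph n} (B : RawGraph m) {σ} → Generator A σ → Generator (union A B) (liftˡ σ)
  lift-generator {A} B {σ} (r , s , k , l , (edge , new , (ρ , iso)) , moves) =
    L r , L s , L k , L l ,
      (trans (union-LL A B r s) edge , lift-new new , (liftˡ ρ , lifted-iso)) , lifted-moves
    where
      lift-new : (k ≢ l × A k l ≡ false) ⊎ samePair k l r s ≡ true →
        (L k ≢ L l × union A B (L k) (L l) ≡ false) ⊎ samePair (L k) (L l) (L r) (L s) ≡ true
      lift-new (inj₁ (k≢l , non-edge)) = inj₁ (k≢l ∘ L-injective , trans (union-LL A B k l) non-edge)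
      lift-new (inj₂ same)             = inj₂ (trans (samePair-injective L L-injective k l r s) same)

      lifted-iso : permute (replace (union A B) (L r) (L s) (L k) (L l)) (liftˡ ρ) ≐ union A B
      lifted-iso x y = trans (replace-union A B r s k l (liftˡ ρ ⟨$⟩ʳ x) (liftˡ ρ ⟨$⟩ʳ y))
                             (permute-union-≐ B ρ iso x y)

      lifted-moves : permute (union A B) (liftˡ σ) ≐ replace (union A B) (L r) (L s) (L k) (L l)
      lifted-moves x y = trans (permute-union-≐ B σ moves x y) (sym (replace-union A B r s k l x y))

  lift-generated : ∀ {A : RawGraph n} (B : RawGraph m) {σ} → Generated (Generator A) σ →
    Spanned (Generator (union A B)) (liftˡ σ)
  lift-generated {A} B (gen {σ} g)        = spanned-gen (lift-generator {A} B {σ} g)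
  lift-generated     B unit               = spanned-≈ spanned-id (λ x → sym (liftˡ-id x))
  lift-generated     B (comp {σ} {τ} g h) = spanned-≈ (spanned-∘ (lift-generated B g) (lift-generated B h)) (liftˡ-∘ σ τ)
  lift-generated     B (inv {σ} g)        = spanned-≈ (spanned-flip (lift-generated B g)) (liftˡ-flip σ)

  amoeba-left-transpositions : ∀ {A : RawGraph n} (B : RawGraph m) → LocalAmoeba A →
    ∀ a b → Spanned (Generator (union A B)) (transpose (L a) (L b))
  amoeba-left-transpositions {A} B amoeba a b with amoeba-spans amoeba (transpose a b)
  ... | spanned {σ} g σ≈ab = spanned-≈ (lift-generated {A} B g) (λ x → trans (liftˡ-cong {σ} {transpose a b} σ≈ab x) (liftˡ-transpose a b x))

empty-isGraph : ∀ t → IsGraph (empty t)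
empty-isGraph t = record { symmetric = λ _ _ → refl ; irreflexive = λ _ → refl }

-- Star at the leaf c of K ∪ tK₁: transpositions (c a) inside K come from K, and
-- (c z) for an isolated z swings the leaf edge of c over to z.
pendant-amoeba-with-isolated : ∀ {n} {K : RawGraph n} {c u} → IsGraph K → LocalAmoeba K →
  Pendant K c u → ∀ t → LocalAmoeba (union K (empty t))
pendant-amoeba-with-isolated {n} {K} {c} graph amoeba leaf t = local-amoeba (star-spans (L c) star)
  where
    open DisjointUnion {n} {t}
    star : ∀ x → Spanned (Generator (union K (empty t))) (transpose (L c) x)
    star x with side x
    ... | left a  = amoeba-left-transpositions (empty t) amoeba c a
    ... | right z = spanned-gen (Swing.pendant-swap-generator (union-isGraph graph (empty-isGraph t))
                      (pendant-union (empty t) leaf) (isolated-union K (λ _ → refl)) L≢R)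

pendant-amoeba-global : ∀ {n} {K : RawGraph n} {c u} → IsGraph K → LocalAmoeba K →
  Pendant K c u → GlobalAmoeba K
pendant-amoeba-global graph amoeba leaf = 0 , λ t _ → pendant-amoeba-with-isolated graph amoeba leaf t

-- The exchange involution on G ∪ H, where v is a leaf of G with neighbour u = v[u′]
-- (v[a] := punchIn v a) and φ : H ≅ G − v.  It fixes v and swaps G − v with H.

module Exchange {m : ℕ} {G : RawGraph (suc m)} {H : RawGraph m}
  (graph-G : IsGraph G) (graph-H : IsGraph H) (amoeba : LocalAmoeba G)
  (v : Fin (suc m)) (u′ : Fin m) (leaf : Pendant G v (punchIn v u′))
  (φ : Permutation′ m) (iso : permute H φ ≐ deleteVertex G v) where

  open DisjointUnion {suc m} {m}

  U : RawGraph (suc m + m)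
  U = union G H

  u : Fin (suc m)
  u = punchIn v u′

  -- the copy of u in H
  w : Fin m
  w = φ ⟨$⟩ʳ u′

  graph-U : IsGraph U
  graph-U = union-isGraph graph-G graph-H

  data Position : Fin (suc m + m) → Set where
    centre : Position (L v)
    inG    : (a : Fin m) → Position (L (punchIn v a))
    inH    : (b : Fin m) → Position (R b)

  position : ∀ x → Position x
  position x with side x
  ... | right b = inH b
  ... | left a with v ≟ a
  ...   | yes refl = centre
  ...   | no v≢a   = subst (Position ∘ L) (punchIn-punchOut v≢a) (inG (punchOut v≢a))

  exchange : Fin (suc m) ⊎ Fin m → Fin (suc m) ⊎ Fin m
  exchange (inj₁ a) with v ≟ a
  ... | yes _  = inj₁ a
  ... | no v≢a = inj₂ (φ ⟨$⟩ʳ punchOut v≢a)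
  exchange (inj₂ b) = inj₁ (punchIn v (φ ⟨$⟩ˡ b))

  exchange-centre : ∀ {a} → v ≡ a → exchange (inj₁ a) ≡ inj₁ a
  exchange-centre {a} v≡a with v ≟ a
  ... | yes _  = refl
  ... | no v≢a = ⊥-elim (v≢a v≡a)

  exchange-G : ∀ a → exchange (inj₁ (punchIn v a)) ≡ inj₂ (φ ⟨$⟩ʳ a)
  exchange-G a with v ≟ punchIn v a
  ... | yes v≡va = ⊥-elim (punchInᵢ≢i v a (sym v≡va))
  ... | no _     = cong (λ z → inj₂ (φ ⟨$⟩ʳ z)) (trans (punchOut-cong v refl) (punchOut-punchIn v))

  exchange-involutive : ∀ s → exchange (exchange s) ≡ s
  exchange-involutive (inj₁ a) with v ≟ a
  ... | yes v≡a = exchange-centre v≡a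
  ... | no v≢a = cong inj₁ (trans (cong (punchIn v) (inverseˡ φ)) (punchIn-punchOut v≢a))
  exchange-involutive (inj₂ b) = trans (exchange-G (φ ⟨$⟩ˡ b)) (cong inj₂ (inverseʳ φ))

  τ : Permutation′ (suc m + m)
  τ = ↔-trans +↔⊎ (↔-trans (mk↔ₛ′ exchange exchange exchange-involutive exchange-involutive) (↔-sym +↔⊎))

  τ-centre : τ ⟨$⟩ʳ L v ≡ L v
  τ-centre rewrite splitAt-↑ˡ (suc m) v m | exchange-centre {v} refl = refl

  τ-G : ∀ a → τ ⟨$⟩ʳ L (punchIn v a) ≡ R (φ ⟨$⟩ʳ a)
  τ-G a rewrite splitAt-↑ˡ (suc m) (punchIn v a) m | exchange-G a = refl

  τ-H : ∀ b → τ ⟨$⟩ʳ R b ≡ L (punchIn v (φ ⟨$⟩ˡ b))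
  τ-H b rewrite splitAt-↑ʳ (suc m) m b = refl

  H-in-G : ∀ b b′ → G (punchIn v (φ ⟨$⟩ˡ b)) (punchIn v (φ ⟨$⟩ˡ b′)) ≡ H b b′
  H-in-G b b′ = trans (sym (iso (φ ⟨$⟩ˡ b) (φ ⟨$⟩ˡ b′))) (cong₂ H (inverseʳ φ) (inverseʳ φ))

  τ-row : ∀ y → U (L v) (τ ⟨$⟩ʳ y) ≡ ⌊ y ≟ R w ⌋
  τ-row y with position y
  ... | centre = trans (cong (U (L v)) τ-centre)
                       (trans (IsGraph.irreflexive graph-U (L v)) (sym (⌊≟⌋-no L≢R)))
  ... | inG a  = trans (cong (U (L v)) (τ-G a)) (trans (union-LR G H v _) (sym (⌊≟⌋-no L≢R)))
  ... | inH b  = begin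
    U (L v) (τ ⟨$⟩ʳ R b)                               ≡⟨ cong (U (L v)) (τ-H b) ⟩
    U (L v) (L (punchIn v (φ ⟨$⟩ˡ b)))                 ≡⟨ union-LL G H v _ ⟩
    G v (punchIn v (φ ⟨$⟩ˡ b))                         ≡⟨ pendant-row leaf _ ⟩
    ⌊ punchIn v (φ ⟨$⟩ˡ b) ≟ punchIn v u′ ⌋             ≡⟨ cong (λ z → ⌊ punchIn v (φ ⟨$⟩ˡ b) ≟ punchIn v z ⌋) (inverseˡ φ) ⟨
    ⌊ punchIn v (φ ⟨$⟩ˡ b) ≟ punchIn v (φ ⟨$⟩ˡ w) ⌋     ≡⟨ ⌊≟⌋-injective (punchIn v ∘ (φ ⟨$⟩ˡ_)) φ⁻¹-punchIn-injective b w ⟩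
    ⌊ b ≟ w ⌋                                          ≡⟨ ⌊≟⌋-injective R R-injective b w ⟨
    ⌊ R b ≟ R w ⌋                                      ∎
    where
      open ≡-Reasoning
      φ⁻¹-punchIn-injective : Injective (punchIn v ∘ (φ ⟨$⟩ˡ_))
      φ⁻¹-punchIn-injective e = permutation-injective (flip φ) (punchIn-injective v _ _ e)

  -- Away from v, τ is an automorphism: it just exchanges G − v and H.
  τ-away : ∀ x y → x ≢ L v → y ≢ L v → U (τ ⟨$⟩ʳ x) (τ ⟨$⟩ʳ y) ≡ U x y
  τ-away x y x≢v y≢v with position x | position y
  ... | centre | _      = ⊥-elim (x≢v refl)
  ... | _      | centre = ⊥-elim (y≢v refl)
  ... | inG a  | inG a′ = trans (cong₂ U (τ-G a) (τ-G a′))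
                            (trans (union-RR G H (φ ⟨$⟩ʳ a) (φ ⟨$⟩ʳ a′))
                                   (trans (iso a a′) (sym (union-LL G H (punchIn v a) (punchIn v a′)))))
  ... | inG a  | inH b  = trans (cong₂ U (τ-G a) (τ-H b))
                            (trans (union-RL G H (φ ⟨$⟩ʳ a) (punchIn v (φ ⟨$⟩ˡ b))) (sym (union-LR G H (punchIn v a) b)))
  ... | inH b  | inG a  = trans (cong₂ U (τ-H b) (τ-G a))
                            (trans (union-LR G H (punchIn v (φ ⟨$⟩ˡ b)) (φ ⟨$⟩ʳ a)) (sym (union-RL G H b (punchIn v a))))
  ... | inH b  | inH b′ = trans (cong₂ U (τ-H b) (τ-H b′))
                            (trans (union-LL G H (punchIn v (φ ⟨$⟩ˡ b)) (punchIn v (φ ⟨$⟩ˡ b′)))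
                                   (trans (H-in-G b b′) (sym (union-RR G H b b′))))

  τ-moves-leaf : permute U τ ≐ replace U (L v) (L u) (L v) (R w)
  τ-moves-leaf = ≐-pivot (permute-undirected sym-U τ) (replace-undirected sym-U _ _ _ _) (L v)
    (λ y → trans (cong (λ z → U z (τ ⟨$⟩ʳ y)) τ-centre)
                 (trans (τ-row y) (sym (pendant-move-row leaf′ (pendant-distinct leaf′ graph-U) L≢R y))))
    (λ x y x≢v y≢v → trans (τ-away x y x≢v y≢v) (sym (replace-pivot-away U x≢v y≢v)))
    where
      sym-U = IsGraph.symmetric graph-U
      leaf′ = pendant-union H leaf

  τ-generator : Generator U τ
  τ-generator = realizes-generator τ (trans (union-LL G H v u) (Pendant.adjacent leaf)) L≢R (union-LR G H v w)
                  τ-moves-leaf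

  -- Star at v: (v a) for a in G by lifting, (v b) for b in H as the τ-conjugate of (v τ(b)).
  union-local-amoeba : LocalAmoeba U
  union-local-amoeba = local-amoeba (star-spans (L v) star)
    where
      star : ∀ x → Spanned (Generator U) (transpose (L v) x)
      star x with side x
      ... | left a  = amoeba-left-transpositions H amoeba v a
      ... | right b =
        spanned-≈ (spanned-transpose-conjugate {ρ = τ} {L v} {L (punchIn v (φ ⟨$⟩ˡ b))} (spanned-gen τ-generator)
                     (amoeba-left-transpositions H amoeba v (punchIn v (φ ⟨$⟩ˡ b))))
                  (λ x → cong₂ (λ p q → PC.transpose p q x) τ-centre τ-to-b)
        where τ-to-b : τ ⟨$⟩ʳ L (punchIn v (φ ⟨$⟩ˡ b)) ≡ R b
              τ-to-b = trans (τ-G (φ ⟨$⟩ˡ b)) (cong R (inverseʳ φ))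

proposition4p2 : (m : ℕ) (G : RawGraph (suc m)) → IsGraph G → LocalAmoeba G
    → (v : Fin (suc m)) → deg G v ≡ 1
    → (H : RawGraph m) → IsGraph H → Iso H (deleteVertex G v)
    → LocalAmoeba (union G H) × GlobalAmoeba (union G H)
proposition4p2 m G graph-G amoeba v deg≡1 H graph-H (φ , iso) with degree-one-pendant G v deg≡1
... | u , leaf = union-local , pendant-amoeba-global (union-isGraph graph-G graph-H) union-local (pendant-union H leaf)
  where
    open DisjointUnion {suc m} {m}

    -- write the neighbour u of v as a vertex of G − v
    v≢u : v ≢ u
    v≢u = pendant-distinct leaf graph-G

    leaf′ : Pendant G v (punchIn v (punchOut v≢u))
    leaf′ = subst (Pendant G v) (sym (punchIn-punchOut v≢u)) leaf

    union-local : LocalAmoeba (union G H)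
    union-local = Exchange.union-local-amoeba graph-G graph-H amoeba v (punchOut v≢u) leaf′ φ iso
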